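{- Suppose the weak $3x+1$ conjecture holds. Then the wild integer semigroup $\mathcal{W}(\mathbb{Z})$ is a free commutative semigroup whose set of (irreducible) generators consists entirely of prime numbers. In other words, every wild number is a prime number.
   Context: For integers $n\ge 0$ let $g(n)=\frac{3n+2}{2n+1}$. The wild semigroup $\mathcal{W}$ is the multiplicative semigroup of positive rationals generated by $\{g(n): n\ge 0\}$ together with $\frac12$ (all finite products, repetitions allowed). The wild integer semigroup is $\mathcal{W}(\mathbb{Z})=\mathcal{W}\cap\mathbb{Z}$, a commutative semigroup with unit $1$. An irreducible element of a commutative semigroup is one that cannot be written as a product of two nonunits; the wild numbers are the irreducible elements of $\mathcal{W}(\mathbb{Z})$. A commutative semigroup (with unit $1$) is free if every element other than $1$ factors uniquely, up to order, as a product of irreducible elements. The weak $3x+1$ conjecture is the assertion that the semigroup $\mathcal{W}^{ -1}=\{w^{ -1}: w\in\mathcal{W}\}$ (which is generated by $\{\frac{2n+1}{3n+2}: n\ge 0\}$ together with $2$) contains every positive integer. -}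

module Defs where

open import Data.Nat as ℕ using (ℕ; zero; suc)
open import Data.Integer using (+_)
open import Data.Rational using (ℚ; _/_; _*_; 1ℚ; ½)
open import Data.List using (List)
open import Data.Nat.ListAction using (product)
open import Data.Sum using (_⊎_)
open import Data.List.Relation.Unary.All using (All)
open import Data.List.Relation.Binary.Permutation.Propositional using (_↭_)
open import Data.Product using (∃; _×_)
open import Relation.Binary.PropositionalEquality using (_≡_; _≢_)
open import Relation.Nullary using (¬_)

g : ℕ → ℚ
g n = + suc (suc (3 ℕ.* n)) / suc (2 ℕ.* n)

data InW : ℚ → Set where
  w-one  : InW 1ℚ
  w-half : InW ½
  w-gen  : (n : ℕ) → InW (g n)
  w-mul  : ∀ {p q} → InW p → InW q → InW (p * q)

-- Weak 3x+1 conjecture: every positive integer m lies in W⁻¹ = {w⁻¹ : w ∈ W},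
-- i.e. 1/m ∈ W.  Positive integers are written suc m.
Weak3x+1 : Set
Weak3x+1 = (m : ℕ) → InW (+ 1 / suc m)

-- The wild integer semigroup W(ℤ) = W ∩ ℤ (its elements are positive).
InWZ : ℕ → Set
InWZ k = InW (+ k / 1)

-- Irreducible elements of W(ℤ) (the only unit of W(ℤ) is 1): wild numbers.
Irreducible : ℕ → Set
Irreducible k = InWZ k × k ≢ 1 ×
  (∀ a b → InWZ a → InWZ b → a ℕ.* b ≡ k → a ≡ 1 ⊎ b ≡ 1)

FreeWZ : Set
FreeWZ = ∀ k → InWZ k → k ≢ 1 →
  (∃ λ (xs : List ℕ) → All Irreducible xs × product xs ≡ k) ×
  (∀ (xs ys : List ℕ) → All Irreducible xs → All Irreducible ys →
     product xs ≡ k → product ys ≡ k → xs ↭ ys)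

{-# OPTIONS --safe #-}
-- Under the weak 3x+1 conjecture every 1/e lies in W, so W(ℤ) is closed under
-- divisors: d = (d·e)·(1/e). An irreducible element of W(ℤ) therefore has no
-- proper divisor in ℕ at all, i.e. it is prime; conversely every prime factor of
-- an element of W(ℤ) lies in W(ℤ) and is irreducible there. Factorisations into
-- irreducibles are thus prime factorisations, which exist and are unique in ℕ.
module Submission where

open import Defs
open import Data.Nat.Primality using (Prime)
open import Data.Product using (_×_)

open import Data.Nat as ℕ using (zero; suc; NonZero)
import Data.Nat.Properties as ℕ
open import Data.Nat.Divisibility using (_∣_; divides; m∣m*n)
open import Data.Nat.ListAction using (product)
open import Data.Nat.ListAction.Properties using (∈⇒∣product)
open import Data.Nat.Primality using (¬prime[1]; prime⇒irreducible; irreducible⇒prime)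
open import Data.Nat.Primality.Factorisation
  using (PrimeFactorisation; factors; factorise; factorisationUnique)
open import Data.Integer as ℤ using (+_)
import Data.Integer.Properties as ℤ
open import Data.Rational as ℚ using (_/_; fromℚᵘ)
import Data.Rational.Properties as ℚ
open import Data.Rational.Unnormalised as ℚᵘ using (ℚᵘ; mkℚᵘ; *≡*)
import Data.Rational.Unnormalised.Properties as ℚᵘ
open import Data.List.Relation.Unary.All as All using (All)
open import Data.List.Relation.Binary.Permutation.Propositional using (_↭_)
open import Data.Product using (∃; _,_)
open import Data.Sum using (_⊎_; inj₁; inj₂)
open import Data.Empty using (⊥-elim)
open import Relation.Nullary using (¬_)
open import Relation.Binary.PropositionalEquality

fromℚᵘ-homo-* : ∀ p q → fromℚᵘ (p ℚᵘ.* q) ≡ fromℚᵘ p ℚ.* fromℚᵘ q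
fromℚᵘ-homo-* p q = ℚ.toℚᵘ-injective (begin
  ℚ.toℚᵘ (fromℚᵘ (p ℚᵘ.* q))                ≈⟨ ℚ.toℚᵘ-fromℚᵘ (p ℚᵘ.* q) ⟩
  p ℚᵘ.* q                                   ≈⟨ ℚᵘ.*-cong (ℚ.toℚᵘ-fromℚᵘ p) (ℚ.toℚᵘ-fromℚᵘ q) ⟨
  ℚ.toℚᵘ (fromℚᵘ p) ℚᵘ.* ℚ.toℚᵘ (fromℚᵘ q)  ≈⟨ ℚ.toℚᵘ-homo-* (fromℚᵘ p) (fromℚᵘ q) ⟨
  ℚ.toℚᵘ (fromℚᵘ p ℚ.* fromℚᵘ q)            ∎)
  where open ℚᵘ.≃-Reasoning

[m*n]/1*1/n≡m/1 : ∀ m n .{{_ : NonZero n}} → (+ (m ℕ.* n) / 1) ℚ.* (+ 1 / n) ≡ + m / 1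
[m*n]/1*1/n≡m/1 m n@(suc n-1) = begin
  (+ (m ℕ.* n) / 1) ℚ.* (+ 1 / n)  ≡⟨ fromℚᵘ-homo-* mn/1 1/n ⟨
  fromℚᵘ (mn/1 ℚᵘ.* 1/n)             ≡⟨ ℚ.fromℚᵘ-cong {mn/1 ℚᵘ.* 1/n} {mkℚᵘ (+ m) 0} (*≡* cross-multiplied) ⟩
  + m / 1                            ∎
  where
  open ≡-Reasoning
  mn/1 1/n : ℚᵘ
  mn/1 = mkℚᵘ (+ (m ℕ.* n)) 0
  1/n  = mkℚᵘ (+ 1) n-1

  cross-multiplied : + (m ℕ.* n) ℤ.* + 1 ℤ.* + 1 ≡ + m ℤ.* + suc (n-1 ℕ.+ 0)
  cross-multiplied = begin
    + (m ℕ.* n) ℤ.* + 1 ℤ.* + 1  ≡⟨ ℤ.*-identityʳ _ ⟩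
    + (m ℕ.* n) ℤ.* + 1          ≡⟨ ℤ.*-identityʳ _ ⟩
    + (m ℕ.* n)                  ≡⟨ ℤ.pos-* m n ⟩
    + m ℤ.* + n                  ≡⟨ cong (λ k → + m ℤ.* + suc k) (ℕ.+-identityʳ n-1) ⟨
    + m ℤ.* + suc (n-1 ℕ.+ 0)    ∎

InW⇒positive : ∀ {p} → InW p → ℚ.Positive p
InW⇒positive w-one               = _
InW⇒positive w-half              = _
InW⇒positive (w-gen n)           = ℚ.normalize-pos (suc (suc (3 ℕ.* n))) (suc (2 ℕ.* n))
InW⇒positive (w-mul {p} {q} a b) = ℚ.pos*pos⇒pos p {{InW⇒positive a}} q {{InW⇒positive b}}

¬InWZ[0] : ¬ InWZ 0
¬InWZ[0] w with () ← subst ℚ.Positive (ℚ.0/n≡0 1) (InW⇒positive w)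

Prime∧InWZ⇒Irreducible : ∀ {p} → Prime p → InWZ p → Irreducible p
Prime∧InWZ⇒Irreducible {p} p-prime w = w , p≢1 , factor≡1
  where
  p≢1 : p ≢ 1
  p≢1 p≡1 = ¬prime[1] (subst Prime p≡1 p-prime)

  factor≡1 : ∀ a b → InWZ a → InWZ b → a ℕ.* b ≡ p → a ≡ 1 ⊎ b ≡ 1
  factor≡1 a b _ _ ab≡p with prime⇒irreducible p-prime (subst (a ∣_) ab≡p (m∣m*n b))
  ... | inj₁ a≡1 = inj₁ a≡1
  ... | inj₂ refl = inj₂ (ℕ.*-cancelˡ-≡ b 1 a {{ℕ.≢-nonZero λ { refl → ¬InWZ[0] w }}}
                                         (trans ab≡p (sym (ℕ.*-identityʳ a))))

module _ (weak3x+1 : Weak3x+1) where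

  InWZ∧∣⇒InWZ : ∀ {k d} → InWZ k → d ∣ k → InWZ d
  InWZ∧∣⇒InWZ w (divides zero refl) = ⊥-elim (¬InWZ[0] w)
  InWZ∧∣⇒InWZ {d = d} w (divides e@(suc e-1) refl) =
    subst InW ([m*n]/1*1/n≡m/1 d e)
      (w-mul (subst InWZ (ℕ.*-comm e d) w) (weak3x+1 e-1))

  Irreducible⇒Prime : ∀ {k} → Irreducible k → Prime k
  Irreducible⇒Prime {zero}            (w , _ , _)        = ⊥-elim (¬InWZ[0] w)
  Irreducible⇒Prime {1}               (_ , k≢1 , _)      = ⊥-elim (k≢1 refl)
  Irreducible⇒Prime {k@(suc (suc _))} (w , _ , factor≡1) = irreducible⇒prime divisor≡1∨k
    where
    divisor≡1∨k : ∀ {d} → d ∣ k → d ≡ 1 ⊎ d ≡ k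
    divisor≡1∨k {d} d∣k@(divides e k≡e*d)
      with factor≡1 d e (InWZ∧∣⇒InWZ w d∣k) (InWZ∧∣⇒InWZ w (divides d k≡d*e)) (sym k≡d*e)
      where
      k≡d*e : k ≡ d ℕ.* e
      k≡d*e = trans k≡e*d (ℕ.*-comm e d)
    ... | inj₁ d≡1 = inj₁ d≡1
    ... | inj₂ refl = inj₂ (sym (trans k≡e*d (ℕ.*-identityˡ d)))

  factors-irreducible : ∀ {k} → InWZ k → (f : PrimeFactorisation k) → All Irreducible (factors f)
  factors-irreducible w f = All.tabulate λ x∈f →
    Prime∧InWZ⇒Irreducible (All.lookup factorsPrime x∈f)
      (InWZ∧∣⇒InWZ w (subst (_ ∣_) (sym isFactorisation) (∈⇒∣product x∈f)))
    where open PrimeFactorisation f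

  irreducibleFactorisation : ∀ {k xs} → All Irreducible xs → product xs ≡ k → PrimeFactorisation k
  irreducibleFactorisation {xs = xs} irr Πxs≡k = record
    { factors         = xs
    ; isFactorisation = sym Πxs≡k
    ; factorsPrime    = All.map Irreducible⇒Prime irr
    }

  irreducibleFactorisation-exists : ∀ {k} → InWZ k → ∃ λ xs → All Irreducible xs × product xs ≡ k
  irreducibleFactorisation-exists {zero}  w = ⊥-elim (¬InWZ[0] w)
  irreducibleFactorisation-exists {suc k} w =
    factors f , factors-irreducible w f , sym (PrimeFactorisation.isFactorisation f)
    where
    f : PrimeFactorisation (suc k)
    f = factorise (suc k)

  irreducibleFactorisation-unique : ∀ {k} xs ys → All Irreducible xs → All Irreducible ys →
                                    product xs ≡ k → product ys ≡ k → xs ↭ ys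
  irreducibleFactorisation-unique xs ys irr-xs irr-ys Πxs≡k Πys≡k =
    factorisationUnique (irreducibleFactorisation irr-xs Πxs≡k) (irreducibleFactorisation irr-ys Πys≡k)

theorem3p2 : Weak3x+1 → FreeWZ × (∀ k → Irreducible k → Prime k)
theorem3p2 weak3x+1 =
  (λ _ w _ → irreducibleFactorisation-exists weak3x+1 w , irreducibleFactorisation-unique weak3x+1)
  , λ _ → Irreducible⇒Prime weak3x+1
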